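{- Let $S_{n-1}$ be the star graph with vertices $v_1,\dots,v_n$, where $v_1$ is the centre, and let $S_n$ be obtained by adding a new vertex $v_{n+1}$ adjacent only to $v_1$. Let $(\mathbf d,\mathbf r)$ be an arithmetical structure on $S_{n-1}$ and let $(\tilde{\mathbf d},\tilde{\mathbf r})$ be the arithmetical structure on $S_n$ given by $\tilde d_{n+1}=1$, $\tilde d_1=d_1+1$, $\tilde d_i=d_i$ for $2\le i\le n$, $\tilde r_{n+1}=r_1$, $\tilde r_i=r_i$ for $1\le i\le n$. Then the critical groups are isomorphic: $\Phi(S_{n-1},\mathbf d,\mathbf r)\cong\Phi(S_n,\tilde{\mathbf d},\tilde{\mathbf r})$.
   Context: For a finite connected graph $G$ on $m$ vertices with adjacency matrix $A$, an arithmetical structure is a pair $(\mathbf d,\mathbf r)$ of positive integer vectors with $\mathbf r$ primitive and $(\mathrm{diag}(\mathbf d)-A)\mathbf r=0$. The critical group $\Phi(G,\mathbf d,\mathbf r)$ is the torsion subgroup of the cokernel $\mathbb Z^m/\mathrm{Im}(\mathrm{diag}(\mathbf d)-A)$, where $\mathrm{diag}(\mathbf d)-A$ is viewed as a $\mathbb Z$-linear map $\mathbb Z^m\to\mathbb Z^m$. -}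

module Defs where

open import Data.Nat as ℕ using (ℕ; zero; suc)
open import Data.Nat.Divisibility using (_∣_)
open import Data.Integer as ℤ using (ℤ; +_; 0ℤ; 1ℤ)
open import Data.Fin as Fin using (Fin; zero; suc; fromℕ)
open import Data.Vec.Functional using (insertAt)
open import Data.Product using (Σ; _×_; ∃; _,_; proj₁)
open import Relation.Nullary using (¬_; yes; no)
open import Relation.Binary.PropositionalEquality using (_≡_)

Vecℤ : ℕ → Set
Vecℤ m = Fin m → ℤ

Matℤ : ℕ → Set
Matℤ m = Fin m → Fin m → ℤ

sumFin : ∀ {m} → (Fin m → ℤ) → ℤ
sumFin {zero}  f = 0ℤ
sumFin {suc m} f = f zero ℤ.+ sumFin (λ i → f (suc i))

_·_ : ∀ {m} → Matℤ m → Vecℤ m → Vecℤ m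
(M · y) i = sumFin (λ j → M i j ℤ.* y j)

_≐_ : ∀ {m} → Vecℤ m → Vecℤ m → Set
x ≐ y = ∀ i → x i ≡ y i

_⊕_ : ∀ {m} → Vecℤ m → Vecℤ m → Vecℤ m
(x ⊕ y) i = x i ℤ.+ y i

_⊖_ : ∀ {m} → Vecℤ m → Vecℤ m → Vecℤ m
(x ⊖ y) i = x i ℤ.- y i

_⊛_ : ∀ {m} → ℤ → Vecℤ m → Vecℤ m
(k ⊛ x) i = k ℤ.* x i

InIm : ∀ {m} → Matℤ m → Vecℤ m → Set
InIm M x = Σ (Vecℤ _) λ y → (M · y) ≐ x

_≈⟨_⟩_ : ∀ {m} → Vecℤ m → Matℤ m → Vecℤ m → Set
x ≈⟨ M ⟩ y = InIm M (x ⊖ y)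

IsTorsion : ∀ {m} → Matℤ m → Vecℤ m → Set
IsTorsion M x = Σ ℤ λ k → ¬ (k ≡ 0ℤ) × InIm M (k ⊛ x)

-- elements of the critical group Φ (torsion subgroup of coker M),
-- represented by vectors; equality is _≈⟨ M ⟩_
Tors : ∀ {m} → Matℤ m → Set
Tors {m} M = Σ (Vecℤ m) (IsTorsion M)

record TorsIso {m n : ℕ} (M : Matℤ m) (N : Matℤ n) : Set where
  field
    to   : Tors M → Tors N
    from : Tors N → Tors M
    to-cong   : ∀ a b → proj₁ a ≈⟨ M ⟩ proj₁ b → proj₁ (to a) ≈⟨ N ⟩ proj₁ (to b)
    from-cong : ∀ a b → proj₁ a ≈⟨ N ⟩ proj₁ b → proj₁ (from a) ≈⟨ M ⟩ proj₁ (from b)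
    to-hom : ∀ a b c → proj₁ c ≐ (proj₁ a ⊕ proj₁ b) →
             proj₁ (to c) ≈⟨ N ⟩ (proj₁ (to a) ⊕ proj₁ (to b))
    from∘to : ∀ a → proj₁ (from (to a)) ≈⟨ M ⟩ proj₁ a
    to∘from : ∀ b → proj₁ (to (from b)) ≈⟨ N ⟩ proj₁ b

_≅Φ_ : ∀ {m n} → Matℤ m → Matℤ n → Set
M ≅Φ N = TorsIso M N

δ : ∀ {m} → Fin m → Fin m → ℤ
δ i j with i Fin.≟ j
... | yes _ = 1ℤ
... | no  _ = 0ℤ

Lap : ∀ {m} → (Fin m → ℕ) → Matℤ m → Matℤ m
Lap d A i j = δ i j ℤ.* (+ d i) ℤ.- A i j

-- adjacency matrix of the star graph on vertices Fin (suc k), centre = zero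
starAdj : ∀ k → Matℤ (suc k)
starAdj k zero    zero    = 0ℤ
starAdj k zero    (suc _) = 1ℤ
starAdj k (suc _) zero    = 1ℤ
starAdj k (suc _) (suc _) = 0ℤ

Primitive : ∀ {m} → (Fin m → ℕ) → Set
Primitive r = ∀ g → (∀ i → g ∣ r i) → g ∣ 1

record IsArithStruct {m} (A : Matℤ m) (d r : Fin m → ℕ) : Set where
  field
    d-pos : ∀ i → 0 ℕ.< d i
    r-pos : ∀ i → 0 ℕ.< r i
    r-prim : Primitive r
    kernel : (Lap d A · (λ i → + r i)) ≐ (λ _ → 0ℤ)

-- the extended structure on S_n: new last vertex v_{n+1}
dExt : ∀ {k} → (Fin (suc k) → ℕ) → Fin (suc (suc k)) → ℕ
dExt {k} d = insertAt d' (fromℕ (suc k)) 1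
  where
  d' : Fin (suc k) → ℕ
  d' zero    = suc (d zero)
  d' (suc i) = d (suc i)

rExt : ∀ {k} → (Fin (suc k) → ℕ) → Fin (suc (suc k)) → ℕ
rExt {k} r = insertAt r (fromℕ (suc k)) (r zero)

{-# OPTIONS --safe #-}
-- Let M and N be the matrices diag(d) − A of S_{n−1} and of S_n, and let p be the new
-- vertex, adjacent only to the centre c and with weight 1.  On the old vertices N is M
-- plus the edge cp:  (N z)_c = (M z′)_c + z_c − z_p  and  (N z)_p = z_p − z_c, where z′
-- forgets z_p.  Hence extension by zero ℤⁿ → ℤⁿ⁺¹ and folding z_p into the centre
-- ℤⁿ⁺¹ → ℤⁿ map Im M into Im N and back (N (y, y_c) = (M y, 0), and the fold of N z is
-- M z′), fold ∘ extend is the identity, and extend ∘ fold differs from the identity by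
-- N (0, −z_p).  So they are inverse isomorphisms of the whole cokernels and restrict to
-- the torsion subgroups.

module Submission where

open import Defs
open import Data.Nat using (ℕ; suc)
open import Data.Fin using (Fin; zero; suc; fromℕ; inject₁; _≟_)
open import Data.Integer using (+_; 0ℤ; 1ℤ; -1ℤ; _+_; _*_; _-_; -_)
open import Data.Integer.Properties
  using ( +-*-semiring; +-identityˡ; +-identityʳ; +-inverseʳ; *-identityˡ; *-zeroˡ; *-zeroʳ
        ; *-distribˡ-+; -1*i≡-i)
open import Data.Integer.Tactic.RingSolver using (solve-∀)
open import Algebra.Properties.Semiring.Sum +-*-semiring
  using (sum; sum-cong-≗; sum-replicate-zero; sum-init-last; ∑-distrib-+; *-distribˡ-sum)
open import Data.Vec.Functional using (Vector; insertAt; init; last; tail; map; zipWith)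
open import Data.Vec.Functional.Properties using (insertAt-lookup)
open import Data.Product using (_,_; proj₁)
open import Relation.Nullary using (yes; no)
open import Relation.Binary.PropositionalEquality
open ≡-Reasoning

sumFin≡sum : ∀ {m} (f : Vecℤ m) → sumFin f ≡ sum f
sumFin≡sum {0}     f = refl
sumFin≡sum {suc m} f = cong (_+_ (f zero)) (sumFin≡sum (tail f))

δ-suc : ∀ {m} (i j : Fin m) → δ (suc i) (suc j) ≡ δ i j
δ-suc i j with i ≟ j
... | yes _ = refl
... | no  _ = refl

sum-δ : ∀ {m} (i : Fin m) (g : Vecℤ m) → sum (λ j → δ i j * g j) ≡ g i
sum-δ {suc m} zero g = begin
  1ℤ * g zero + sum (λ j → 0ℤ * g (suc j))
    ≡⟨ cong₂ _+_ (*-identityˡ (g zero)) (sum-cong-≗ (λ j → *-zeroˡ (g (suc j)))) ⟩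
  g zero + sum {m} (λ _ → 0ℤ)
    ≡⟨ cong (_+_ (g zero)) (sum-replicate-zero m) ⟩
  g zero + 0ℤ
    ≡⟨ +-identityʳ (g zero) ⟩
  g zero ∎
sum-δ (suc i) g = begin
  0ℤ * g zero + sum (λ j → δ (suc i) (suc j) * g (suc j))
    ≡⟨ cong₂ _+_ (*-zeroˡ (g zero)) (sum-cong-≗ (λ j → cong (_* g (suc j)) (δ-suc i j))) ⟩
  0ℤ + sum (λ j → δ i j * g (suc j))
    ≡⟨ cong (_+_ 0ℤ) (sum-δ i (tail g)) ⟩
  0ℤ + g (suc i)
    ≡⟨ +-identityˡ (g (suc i)) ⟩
  g (suc i) ∎

·-cong : ∀ {m} (M : Matℤ m) {y y′ : Vecℤ m} → y ≐ y′ → (M · y) ≐ (M · y′)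
·-cong M {y} {y′} y≐y′ i = begin
  sumFin (λ j → M i j * y j)  ≡⟨ sumFin≡sum (λ j → M i j * y j) ⟩
  sum (λ j → M i j * y j)     ≡⟨ sum-cong-≗ (λ j → cong (M i j *_) (y≐y′ j)) ⟩
  sum (λ j → M i j * y′ j)    ≡⟨ sumFin≡sum (λ j → M i j * y′ j) ⟨
  sumFin (λ j → M i j * y′ j) ∎

·-zeroʳ : ∀ {m} (M : Matℤ m) → (M · (λ _ → 0ℤ)) ≐ (λ _ → 0ℤ)
·-zeroʳ {m} M i = begin
  sumFin (λ j → M i j * 0ℤ) ≡⟨ sumFin≡sum (λ j → M i j * 0ℤ) ⟩
  sum (λ j → M i j * 0ℤ)    ≡⟨ sum-cong-≗ (λ j → *-zeroʳ (M i j)) ⟩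
  sum {m} (λ _ → 0ℤ)        ≡⟨ sum-replicate-zero m ⟩
  0ℤ                        ∎

Lap-· : ∀ {m} (d : Fin m → ℕ) (A : Matℤ m) (y : Vecℤ m) i →
        (Lap d A · y) i ≡ + d i * y i - (A · y) i
Lap-· d A y i = begin
  sumFin (λ j → (δ i j * + d i - A i j) * y j)
    ≡⟨ sumFin≡sum (λ j → (δ i j * + d i - A i j) * y j) ⟩
  sum (λ j → (δ i j * + d i - A i j) * y j)
    ≡⟨ sum-cong-≗ (λ j → expand (δ i j) (+ d i) (A i j) (y j)) ⟩
  sum (λ j → δ i j * (+ d i * y j) + -1ℤ * (A i j * y j))
    ≡⟨ ∑-distrib-+ (λ j → δ i j * (+ d i * y j)) (λ j → -1ℤ * (A i j * y j)) ⟩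
  sum (λ j → δ i j * (+ d i * y j)) + sum (map (-1ℤ *_) (λ j → A i j * y j))
    ≡⟨ cong₂ _+_ (sum-δ i (λ j → + d i * y j)) (sym (*-distribˡ-sum -1ℤ (λ j → A i j * y j))) ⟩
  + d i * y i + -1ℤ * sum (λ j → A i j * y j)
    ≡⟨ cong (_+_ (+ d i * y i)) (trans (-1*i≡-i _) (cong -_ (sym (sumFin≡sum (λ j → A i j * y j))))) ⟩
  + d i * y i - (A · y) i ∎
  where
  expand : ∀ a b c e → (a * b - c) * e ≡ a * (b * e) + -1ℤ * (c * e)
  expand = solve-∀

starAdj-·-centre : ∀ k (y : Vecℤ (suc k)) → (starAdj k · y) zero ≡ sum (tail y)
starAdj-·-centre k y = begin
  0ℤ * y zero + sumFin (λ j → 1ℤ * y (suc j))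
    ≡⟨ cong₂ _+_ (*-zeroˡ (y zero)) (sumFin≡sum (λ j → 1ℤ * y (suc j))) ⟩
  0ℤ + sum (λ j → 1ℤ * y (suc j))
    ≡⟨ +-identityˡ _ ⟩
  sum (λ j → 1ℤ * y (suc j))
    ≡⟨ sum-cong-≗ (λ j → *-identityˡ (y (suc j))) ⟩
  sum (tail y) ∎

starAdj-·-leaf : ∀ k (y : Vecℤ (suc k)) i → (starAdj k · y) (suc i) ≡ y zero
starAdj-·-leaf k y i = begin
  1ℤ * y zero + sumFin (λ j → 0ℤ * y (suc j))
    ≡⟨ cong (_+_ (1ℤ * y zero)) (sumFin≡sum (λ j → 0ℤ * y (suc j))) ⟩
  1ℤ * y zero + sum (λ j → 0ℤ * y (suc j))
    ≡⟨ cong₂ _+_ (*-identityˡ (y zero)) (sum-cong-≗ (λ j → *-zeroˡ (y (suc j)))) ⟩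
  y zero + sum {k} (λ _ → 0ℤ)
    ≡⟨ cong (_+_ (y zero)) (sum-replicate-zero k) ⟩
  y zero + 0ℤ
    ≡⟨ +-identityʳ (y zero) ⟩
  y zero ∎

module _ (k : ℕ) (d : Fin (suc k) → ℕ) (y : Vecℤ (suc k)) where

  starLap-·-centre : (Lap d (starAdj k) · y) zero ≡ + d zero * y zero - sum (tail y)
  starLap-·-centre =
    trans (Lap-· d (starAdj k) y zero) (cong (λ s → + d zero * y zero - s) (starAdj-·-centre k y))

  starLap-·-leaf : ∀ i → (Lap d (starAdj k) · y) (suc i) ≡ + d (suc i) * y (suc i) - y zero
  starLap-·-leaf i =
    trans (Lap-· d (starAdj k) y (suc i)) (cong (λ s → + d (suc i) * y (suc i) - s) (starAdj-·-leaf k y i))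

module _ {a} {A : Set a} where

  insertAt-fromℕ-inject₁ : ∀ {n} (xs : Vector A n) v i →
                           insertAt xs (fromℕ n) v (inject₁ i) ≡ xs i
  insertAt-fromℕ-inject₁ {suc n} xs v zero    = refl
  insertAt-fromℕ-inject₁ {suc n} xs v (suc i) = insertAt-fromℕ-inject₁ (tail xs) v i

  init-last-≗ : ∀ {n} {xs ys : Vector A (suc n)} → init xs ≗ init ys → last xs ≡ last ys → xs ≗ ys
  init-last-≗ {0}     _   eq zero    = eq
  init-last-≗ {suc n} eqs _  zero    = eqs zero
  init-last-≗ {suc n} eqs eq (suc j) = init-last-≗ (λ i → eqs (suc i)) eq j

  insertAt-cong : ∀ {n} {xs ys : Vector A n} {u v} → xs ≗ ys → u ≡ v →
                  ∀ i → insertAt xs i u ≗ insertAt ys i v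
  insertAt-cong         _   u≡v zero    zero    = u≡v
  insertAt-cong         eqs _   zero    (suc j) = eqs j
  insertAt-cong {suc n} eqs _   (suc i) zero    = eqs zero
  insertAt-cong {suc n} eqs u≡v (suc i) (suc j) = insertAt-cong (λ j → eqs (suc j)) u≡v i j

  insertAt-map : ∀ {b} {B : Set b} {n} (f : A → B) (xs : Vector A n) v i →
                 insertAt (map f xs) i (f v) ≗ map f (insertAt xs i v)
  insertAt-map             f xs v zero    zero    = refl
  insertAt-map             f xs v zero    (suc j) = refl
  insertAt-map {n = suc n} f xs v (suc i) zero    = refl
  insertAt-map {n = suc n} f xs v (suc i) (suc j) = insertAt-map f (tail xs) v i j

  insertAt-zipWith : ∀ {b c} {B : Set b} {C : Set c} {n}
                     (f : A → B → C) (xs : Vector A n) ys u v i →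
                     insertAt (zipWith f xs ys) i (f u v) ≗
                     zipWith f (insertAt xs i u) (insertAt ys i v)
  insertAt-zipWith             f xs ys u v zero    zero    = refl
  insertAt-zipWith             f xs ys u v zero    (suc j) = refl
  insertAt-zipWith {n = suc n} f xs ys u v (suc i) zero    = refl
  insertAt-zipWith {n = suc n} f xs ys u v (suc i) (suc j) =
    insertAt-zipWith f (tail xs) (tail ys) u v i j

record IsLinear {m n} (f : Vecℤ m → Vecℤ n) : Set where
  field
    cong-≐ : ∀ {x y} → x ≐ y → f x ≐ f y
    homo-⊕ : ∀ x y → f (x ⊕ y) ≐ (f x ⊕ f y)
    homo-⊛ : ∀ c x → f (c ⊛ x) ≐ (c ⊛ f x)

  homo-⊖ : ∀ x y → f (x ⊖ y) ≐ (f x ⊖ f y)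
  homo-⊖ x y i = begin
    f (x ⊖ y) i              ≡⟨ cong-≐ (λ j → cong (_+_ (x j)) (-1*i≡-i (y j))) i ⟨
    f (x ⊕ (-1ℤ ⊛ y)) i      ≡⟨ homo-⊕ x (-1ℤ ⊛ y) i ⟩
    f x i + f (-1ℤ ⊛ y) i    ≡⟨ cong (_+_ (f x i)) (trans (homo-⊛ -1ℤ y i) (-1*i≡-i (f y i))) ⟩
    f x i - f y i            ∎

InIm-resp : ∀ {m} {M : Matℤ m} {x x′ : Vecℤ m} → InIm M x → x ≐ x′ → InIm M x′
InIm-resp (y , My≐x) x≐x′ = y , λ i → trans (My≐x i) (x≐x′ i)

≐⇒≈ : ∀ {m} {M : Matℤ m} {x y : Vecℤ m} → x ≐ y → x ≈⟨ M ⟩ y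
≐⇒≈ {M = M} {x} {y} x≐y = (λ _ → 0ℤ) , λ i → begin
  (M · (λ _ → 0ℤ)) i ≡⟨ ·-zeroʳ M i ⟩
  0ℤ                 ≡⟨ +-inverseʳ (y i) ⟨
  y i - y i          ≡⟨ cong (_- y i) (x≐y i) ⟨
  x i - y i          ∎

record CokernelMap {m n} (M : Matℤ m) (N : Matℤ n) : Set where
  field
    fun    : Vecℤ m → Vecℤ n
    linear : IsLinear fun
    image  : ∀ y → InIm N (fun (M · y))

  open IsLinear linear public

  fun-InIm : ∀ {x} → InIm M x → InIm N (fun x)
  fun-InIm (y , My≐x) = InIm-resp {M = N} (image y) (cong-≐ My≐x)

  fun-≈ : ∀ {x y} → x ≈⟨ M ⟩ y → fun x ≈⟨ N ⟩ fun y
  fun-≈ x≈y = InIm-resp {M = N} (fun-InIm x≈y) (homo-⊖ _ _)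

  fun-IsTorsion : ∀ {x} → IsTorsion M x → IsTorsion N (fun x)
  fun-IsTorsion (c , c≢0 , cx∈Im) = c , c≢0 , InIm-resp {M = N} (fun-InIm cx∈Im) (homo-⊛ c _)

  funΦ : Tors M → Tors N
  funΦ (x , x-tors) = fun x , fun-IsTorsion x-tors

record CokernelIso {m n} (M : Matℤ m) (N : Matℤ n) : Set where
  field
    to      : CokernelMap M N
    from    : CokernelMap N M
  open CokernelMap to   renaming (fun to to-fun)
  open CokernelMap from renaming (fun to from-fun)
  field
    from∘to : ∀ x → from-fun (to-fun x) ≈⟨ M ⟩ x
    to∘from : ∀ y → to-fun (from-fun y) ≈⟨ N ⟩ y

CokernelIso⇒≅Φ : ∀ {m n} {M : Matℤ m} {N : Matℤ n} → CokernelIso M N → M ≅Φ N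
CokernelIso⇒≅Φ {N = N} iso = record
  { to        = To.funΦ
  ; from      = From.funΦ
  ; to-cong   = λ _ _ → To.fun-≈
  ; from-cong = λ _ _ → From.fun-≈
  ; to-hom    = λ _ _ _ c≐a⊕b →
                  ≐⇒≈ {M = N} (λ i → trans (To.cong-≐ c≐a⊕b i) (To.homo-⊕ _ _ i))
  ; from∘to   = λ a → from∘to (proj₁ a)
  ; to∘from   = λ b → to∘from (proj₁ b)
  }
  where
  open CokernelIso iso
  module To   = CokernelMap to
  module From = CokernelMap from

module PendantLeaf (k : ℕ) (d : Fin (suc k) → ℕ) where

  M : Matℤ (suc k)
  M = Lap d (starAdj k)

  N : Matℤ (suc (suc k))
  N = Lap (dExt d) (starAdj (suc k))

  pendant : Fin (suc (suc k))
  pendant = fromℕ (suc k)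

  ≐-by-vertices : ∀ {x y : Vecℤ (suc (suc k))} → x zero ≡ y zero →
                  (∀ i → x (suc (inject₁ i)) ≡ y (suc (inject₁ i))) → last x ≡ last y → x ≐ y
  ≐-by-vertices centre leaves = init-last-≗ λ { zero → centre ; (suc i) → leaves i }

  N-·-centre : ∀ z → (N · z) zero ≡ (M · init z) zero + (z zero - last z)
  N-·-centre z = begin
    (N · z) zero
      ≡⟨ starLap-·-centre (suc k) (dExt d) z ⟩
    + suc (d zero) * z zero - sum (tail z)
      ≡⟨ cong (λ s → + suc (d zero) * z zero - s) (sum-init-last (tail z)) ⟩
    (1ℤ + + d zero) * z zero - (sum (tail (init z)) + last z)
      ≡⟨ regroup (+ d zero) (z zero) (sum (tail (init z))) (last z) ⟩
    (+ d zero * z zero - sum (tail (init z))) + (z zero - last z)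
      ≡⟨ cong (_+ (z zero - last z)) (starLap-·-centre k d (init z)) ⟨
    (M · init z) zero + (z zero - last z) ∎
    where
    regroup : ∀ a x s l → (1ℤ + a) * x - (s + l) ≡ (a * x - s) + (x - l)
    regroup = solve-∀

  N-·-leaf : ∀ z i → (N · z) (suc (inject₁ i)) ≡ (M · init z) (suc i)
  N-·-leaf z i = begin
    (N · z) (suc (inject₁ i))
      ≡⟨ starLap-·-leaf (suc k) (dExt d) z (inject₁ i) ⟩
    + dExt d (suc (inject₁ i)) * z (suc (inject₁ i)) - z zero
      ≡⟨ cong (λ a → + a * z (suc (inject₁ i)) - z zero) (insertAt-fromℕ-inject₁ (tail d) 1 i) ⟩
    + d (suc i) * init z (suc i) - init z zero
      ≡⟨ starLap-·-leaf k d (init z) i ⟨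
    (M · init z) (suc i) ∎

  N-·-pendant : ∀ z → last (N · z) ≡ last z - z zero
  N-·-pendant z = begin
    (N · z) pendant
      ≡⟨ starLap-·-leaf (suc k) (dExt d) z (fromℕ k) ⟩
    + dExt d pendant * last z - z zero
      ≡⟨ cong (λ a → + a * last z - z zero) (insertAt-lookup (tail d) (fromℕ k) 1) ⟩
    1ℤ * last z - z zero
      ≡⟨ cong (_- z zero) (*-identityˡ (last z)) ⟩
    last z - z zero ∎

  extendByZero : Vecℤ (suc k) → Vecℤ (suc (suc k))
  extendByZero x = insertAt x pendant 0ℤ

  foldPendant : Vecℤ (suc (suc k)) → Vecℤ (suc k)
  foldPendant z zero    = z zero + last z
  foldPendant z (suc i) = z (suc (inject₁ i))

  extendByZero-linear : IsLinear extendByZero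
  extendByZero-linear = record
    { cong-≐ = λ x≐y → insertAt-cong x≐y refl pendant
    ; homo-⊕ = λ x y → insertAt-zipWith _+_ x y 0ℤ 0ℤ pendant
    ; homo-⊛ = λ c x i →
        trans (insertAt-cong {xs = c ⊛ x} (λ _ → refl) (sym (*-zeroʳ c)) pendant i)
              (insertAt-map (c *_) x 0ℤ pendant i)
    }

  foldPendant-linear : IsLinear foldPendant
  foldPendant-linear = record
    { cong-≐ = λ { x≐y zero    → cong₂ _+_ (x≐y zero) (x≐y pendant)
                 ; x≐y (suc i) → x≐y (suc (inject₁ i)) }
    ; homo-⊕ = λ { x y zero    → middle-swap (x zero) (y zero) (last x) (last y)
                 ; x y (suc i) → refl }
    ; homo-⊛ = λ { c x zero    → sym (*-distribˡ-+ c (x zero) (last x))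
                 ; c x (suc i) → refl }
    }
    where
    middle-swap : ∀ a b c e → (a + b) + (c + e) ≡ (a + c) + (b + e)
    middle-swap = solve-∀

  N-·-extend : ∀ y → (N · insertAt y pendant (y zero)) ≐ extendByZero (M · y)
  N-·-extend y = ≐-by-vertices centre leaves pendant-row
    where
    ŷ : Vecℤ (suc (suc k))
    ŷ = insertAt y pendant (y zero)

    M·init-ŷ : (M · init ŷ) ≐ (M · y)
    M·init-ŷ = ·-cong M (insertAt-fromℕ-inject₁ y (y zero))

    last-ŷ : last ŷ ≡ y zero
    last-ŷ = insertAt-lookup y pendant (y zero)

    centre : (N · ŷ) zero ≡ (M · y) zero
    centre = begin
      (N · ŷ) zero                            ≡⟨ N-·-centre ŷ ⟩
      (M · init ŷ) zero + (y zero - last ŷ)   ≡⟨ cong₂ (λ a l → a + (y zero - l)) (M·init-ŷ zero) last-ŷ ⟩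
      (M · y) zero + (y zero - y zero)        ≡⟨ cong (_+_ ((M · y) zero)) (+-inverseʳ (y zero)) ⟩
      (M · y) zero + 0ℤ                       ≡⟨ +-identityʳ ((M · y) zero) ⟩
      (M · y) zero                            ∎

    leaves : ∀ i → (N · ŷ) (suc (inject₁ i)) ≡ extendByZero (M · y) (suc (inject₁ i))
    leaves i = begin
      (N · ŷ) (suc (inject₁ i))                 ≡⟨ N-·-leaf ŷ i ⟩
      (M · init ŷ) (suc i)                      ≡⟨ M·init-ŷ (suc i) ⟩
      (M · y) (suc i)                           ≡⟨ insertAt-fromℕ-inject₁ (M · y) 0ℤ (suc i) ⟨
      extendByZero (M · y) (suc (inject₁ i))    ∎

    pendant-row : last (N · ŷ) ≡ last (extendByZero (M · y))
    pendant-row = begin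
      last (N · ŷ)                      ≡⟨ N-·-pendant ŷ ⟩
      last ŷ - y zero                   ≡⟨ cong (_- y zero) last-ŷ ⟩
      y zero - y zero                   ≡⟨ +-inverseʳ (y zero) ⟩
      0ℤ                                ≡⟨ insertAt-lookup (M · y) pendant 0ℤ ⟨
      last (extendByZero (M · y))       ∎

  foldPendant-N-· : ∀ z → foldPendant (N · z) ≐ (M · init z)
  foldPendant-N-· z zero = begin
    (N · z) zero + last (N · z)
      ≡⟨ cong₂ _+_ (N-·-centre z) (N-·-pendant z) ⟩
    ((M · init z) zero + (z zero - last z)) + (last z - z zero)
      ≡⟨ cancel ((M · init z) zero) (z zero) (last z) ⟩
    (M · init z) zero ∎
    where
    cancel : ∀ a x l → (a + (x - l)) + (l - x) ≡ a
    cancel = solve-∀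
  foldPendant-N-· z (suc i) = N-·-leaf z i

  foldPendant∘extendByZero : ∀ x → foldPendant (extendByZero x) ≐ x
  foldPendant∘extendByZero x zero    =
    trans (cong (_+_ (x zero)) (insertAt-lookup x pendant 0ℤ)) (+-identityʳ (x zero))
  foldPendant∘extendByZero x (suc i) = insertAt-fromℕ-inject₁ x 0ℤ (suc i)

  extendByZero∘foldPendant : ∀ z → extendByZero (foldPendant z) ≈⟨ N ⟩ z
  extendByZero∘foldPendant z = w , ≐-by-vertices centre leaves pendant-row
    where
    w : Vecℤ (suc (suc k))
    w = insertAt (λ _ → 0ℤ) pendant (- last z)

    M·init-w : (M · init w) ≐ (λ _ → 0ℤ)
    M·init-w i = trans (·-cong M (insertAt-fromℕ-inject₁ (λ _ → 0ℤ) (- last z)) i) (·-zeroʳ M i)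

    last-w : last w ≡ - last z
    last-w = insertAt-lookup (λ _ → 0ℤ) pendant (- last z)

    centre : (N · w) zero ≡ (z zero + last z) - z zero
    centre = begin
      (N · w) zero                      ≡⟨ N-·-centre w ⟩
      (M · init w) zero + (0ℤ - last w) ≡⟨ cong₂ (λ a l → a + (0ℤ - l)) (M·init-w zero) last-w ⟩
      0ℤ + (0ℤ - - last z)              ≡⟨ shift (z zero) (last z) ⟩
      (z zero + last z) - z zero        ∎
      where
      shift : ∀ a l → 0ℤ + (0ℤ - - l) ≡ (a + l) - a
      shift = solve-∀

    leaves : ∀ i → (N · w) (suc (inject₁ i)) ≡ (extendByZero (foldPendant z) ⊖ z) (suc (inject₁ i))
    leaves i = begin
      (N · w) (suc (inject₁ i))          ≡⟨ N-·-leaf w i ⟩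
      (M · init w) (suc i)               ≡⟨ M·init-w (suc i) ⟩
      0ℤ                                 ≡⟨ +-inverseʳ (z (suc (inject₁ i))) ⟨
      z (suc (inject₁ i)) - z (suc (inject₁ i))
        ≡⟨ cong (_- z (suc (inject₁ i))) (insertAt-fromℕ-inject₁ (foldPendant z) 0ℤ (suc i)) ⟨
      extendByZero (foldPendant z) (suc (inject₁ i)) - z (suc (inject₁ i)) ∎

    pendant-row : last (N · w) ≡ last (extendByZero (foldPendant z)) - last z
    pendant-row = begin
      last (N · w)                                  ≡⟨ N-·-pendant w ⟩
      last w - 0ℤ                                   ≡⟨ cong (_- 0ℤ) last-w ⟩
      - last z - 0ℤ                                 ≡⟨ flip (last z) ⟩
      0ℤ - last z
        ≡⟨ cong (_- last z) (insertAt-lookup (foldPendant z) pendant 0ℤ) ⟨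
      last (extendByZero (foldPendant z)) - last z  ∎
      where
      flip : ∀ l → - l - 0ℤ ≡ 0ℤ - l
      flip = solve-∀

  cokernelIso : CokernelIso M N
  cokernelIso = record
    { to      = record
      { fun    = extendByZero
      ; linear = extendByZero-linear
      ; image  = λ y → insertAt y pendant (y zero) , N-·-extend y
      }
    ; from    = record
      { fun    = foldPendant
      ; linear = foldPendant-linear
      ; image  = λ z → init z , λ i → sym (foldPendant-N-· z i)
      }
    ; from∘to = λ x → ≐⇒≈ {M = M} (foldPendant∘extendByZero x)
    ; to∘from = extendByZero∘foldPendant
    }

mainTheorem13 : (k : ℕ) (d r : Fin (suc k) → ℕ) →
    IsArithStruct (starAdj k) d r →
    Lap d (starAdj k) ≅Φ Lap (dExt d) (starAdj (suc k))
mainTheorem13 k d r _ = CokernelIso⇒≅Φ (PendantLeaf.cokernelIso k d)
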